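{- Let $G=(V,E)$ be a finite simple graph with maximal degree $\Delta$ such that every vertex of degree strictly less than $\Delta$ is a separation vertex, and suppose $G$ has $k$ separation vertices. If $|V|\ge 2\Delta+\Delta^2+\Delta^3$, then $G$ can be transformed by at most $3k\Delta$ edge additions/removals into a graph all of whose vertices have degree $\Delta$ or $\Delta-1$.
   Context: All graphs are finite and simple. A vertex $v$ of a graph is a separation vertex if it has a neighbor $w$ with $\deg(w)>\deg(v)$. -}

module Defs where

open import Data.Nat using (ℕ; zero; suc; _+_; _*_; _∸_; _⊔_; _<_; _≤_)
open import Data.Bool using (Bool; true; false; if_then_else_; _∧_; _xor_)
open import Data.Fin using (Fin; toℕ)
open import Data.List using (List; map; foldr)
open import Data.Nat.ListAction using (sum)
open import Data.Bool.ListAction using (any)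
open import Data.List.Base using (allFin)
open import Data.Product using (Σ; ∃; _×_)
open import Relation.Binary.PropositionalEquality using (_≡_)
open import Relation.Nullary.Decidable using (⌊_⌋)
open import Data.Nat using (_<?_)

record Graph (n : ℕ) : Set where
  field
    adj   : Fin n → Fin n → Bool
    sym   : ∀ i j → adj i j ≡ adj j i
    irrefl : ∀ i → adj i i ≡ false
open Graph public

count : ∀ {n} → (Fin n → Bool) → ℕ
count {n} p = sum (map (λ i → if p i then 1 else 0) (allFin n))

degree : ∀ {n} → Graph n → Fin n → ℕ
degree G v = count (adj G v)

maxDegree : ∀ {n} → Graph n → ℕ
maxDegree {n} G = foldr _⊔_ 0 (map (degree G) (allFin n))

IsSeparationVertex : ∀ {n} → Graph n → Fin n → Set
IsSeparationVertex G v = ∃ λ w → adj G v w ≡ true × degree G v < degree G w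

isSep : ∀ {n} → Graph n → Fin n → Bool
isSep {n} G v = any (λ w → adj G v w ∧ ⌊ degree G v <? degree G w ⌋) (allFin n)

numSeparationVertices : ∀ {n} → Graph n → ℕ
numSeparationVertices G = count (isSep G)

-- edit distance: number of unordered pairs {i,j} (toℕ i < toℕ j) whose adjacency
-- differs, i.e. the minimal number of single edge additions/removals turning G into H
editDistance : ∀ {n} → Graph n → Graph n → ℕ
editDistance {n} G H =
  sum (map (λ i → count (λ j → ⌊ toℕ i <? toℕ j ⌋ ∧ (adj G i j xor adj H i j))) (allFin n))

{-# OPTIONS --safe #-}
-- Write Δ for the maximum degree and (Δ − 1) ∸ deg v for the deficiency of a vertex v.
-- While some v has degree below Δ − 1, raise its degree without pushing any degree above Δ:
-- if a non-neighbour u of v has degree below Δ, add the edge vu; otherwise v still has a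
-- non-neighbour x (as deg v + 2 ≤ Δ ≤ n), x has degree Δ > deg v, so x has a neighbour y not
-- adjacent to v, and replacing the edge xy by vx and vy raises deg v by two and fixes every
-- other degree. Each step costs at most three edits and lowers the total deficiency, which is
-- at most kΔ because only separation vertices have positive deficiency.

module Submission where

open import Defs hiding (sym)

open import Data.Bool using (Bool; true; false; not; _∧_; _xor_; if_then_else_; T)
open import Data.Bool.Properties
  using (xor-same; xor-comm; xor-identityʳ; ∧-zeroʳ; T-≡; T-∧; ¬-not) renaming (_≟_ to _≟ᵇ_)
open import Data.Empty using (⊥-elim)
open import Data.Fin using (Fin; zero; suc; toℕ)
open import Data.Fin.Properties using (_≟_; any?; suc-injective)
open import Data.List using (_∷_; map; foldr; allFin)
open import Data.List.Membership.Propositional using (_∈_; lose)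
open import Data.List.Membership.Propositional.Properties using (∈-map⁺; ∈-allFin)
open import Data.List.Properties using (map-tabulate; map-cong)
open import Data.List.Relation.Unary.Any using (here; there)
open import Data.List.Relation.Unary.Any.Properties using (any⁺)
open import Data.Nat using (ℕ; zero; suc; _+_; _*_; _∸_; _≤_; _<_; _⊔_; z≤n; s≤s; s≤s⁻¹; _<?_)
open import Data.Nat.ListAction using (sum)
open import Data.Nat.Properties
  using ( ≤-refl; ≤-reflexive; ≤-trans; ≤-antisym; ≤-total; <-trans; <-≤-trans; ≤-<-trans; <-irrefl
        ; <⇒≤; <⇒≱; ≮⇒≥; n≤1+n; n<1+n; m≤m+n; m≤n+m; n≤0⇒n≡0; m≤n⇒m<n∨m≡n; n≮0
        ; +-mono-≤; +-monoʳ-≤; +-mono-<-≤; +-mono-≤-<; +-identityʳ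
        ; *-identityˡ; *-identityʳ; *-zeroʳ; *-suc; *-assoc; *-distribʳ-+; *-monoʳ-≤
        ; ∸-monoʳ-≤; ∸-monoʳ-<; m∸n≤m; m∸n≢0⇒n<m; n>0⇒n≢0; m≤m⊔n; m≤n⊔m
        ; +-commutativeSemigroup; module ≤-Reasoning )
open import Algebra.Properties.CommutativeSemigroup +-commutativeSemigroup using (interchange; x∙yz≈y∙xz)
open import Data.Product using (Σ; ∃; _×_; _,_; proj₁; proj₂)
import Data.Product as Product
open import Data.Sum using (_⊎_; inj₁; inj₂)
import Data.Sum as Sum
open import Function using (_∘_; id)
open import Function.Bundles using (Equivalence; mk⇔)
open import Relation.Binary.PropositionalEquality
open import Relation.Nullary using (¬_; Dec; does; yes; no; contradiction)
open import Relation.Nullary.Decidable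
  using (⌊_⌋; _×-dec_; _⊎-dec_; ¬?; dec-true; dec-false; does-⇔; decidable-stable; fromWitness)

<∸1⇒suc< : ∀ {m n} → m < n ∸ 1 → suc m < n
<∸1⇒suc< {n = suc n} m<n = s≤s m<n

m≤n∧n∸1≤m⇒m≡n⊎m≡n∸1 : ∀ {m n} → m ≤ n → n ∸ 1 ≤ m → m ≡ n ⊎ m ≡ n ∸ 1
m≤n∧n∸1≤m⇒m≡n⊎m≡n∸1 {n = zero}  m≤0 _ = inj₁ (n≤0⇒n≡0 m≤0)
m≤n∧n∸1≤m⇒m≡n⊎m≡n∸1 {n = suc n} m≤1+n n≤m with m≤n⇒m<n∨m≡n m≤1+n
... | inj₁ m<1+n = inj₂ (≤-antisym (s≤s⁻¹ m<1+n) n≤m)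
... | inj₂ m≡1+n = inj₁ m≡1+n

≤-foldr-⊔ : ∀ {x xs} → x ∈ xs → x ≤ foldr _⊔_ 0 xs
≤-foldr-⊔ (here refl)  = m≤m⊔n _ _
≤-foldr-⊔ (there x∈xs) = ≤-trans (≤-foldr-⊔ x∈xs) (m≤n⊔m _ _)

-- count p unfolds to ∑ (indicator ∘ p), and degree and editDistance are built from count,
-- so the lemmas on ∑ below apply to them as they stand.
∑ : ∀ {n} → (Fin n → ℕ) → ℕ
∑ {n} f = sum (map f (allFin n))

indicator : Bool → ℕ
indicator b = if b then 1 else 0

∑-suc : ∀ {n} (f : Fin (suc n) → ℕ) → ∑ f ≡ f zero + ∑ (f ∘ suc)
∑-suc f = cong sum (trans (map-tabulate id f) (cong (f zero ∷_) (sym (map-tabulate id (f ∘ suc)))))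

∑-cong : ∀ {n} {f g : Fin n → ℕ} → (∀ x → f x ≡ g x) → ∑ f ≡ ∑ g
∑-cong {n} f≗g = cong sum (map-cong f≗g (allFin n))

∑-const : ∀ n c → ∑ {n} (λ _ → c) ≡ n * c
∑-const zero    c = refl
∑-const (suc n) c = trans (∑-suc {n} (λ _ → c)) (cong (c +_) (∑-const n c))

∑-mono-≤ : ∀ {n} {f g : Fin n → ℕ} → (∀ x → f x ≤ g x) → ∑ f ≤ ∑ g
∑-mono-≤ {zero}          _   = z≤n
∑-mono-≤ {suc n} {f} {g} f≤g rewrite ∑-suc f | ∑-suc g =
  +-mono-≤ (f≤g zero) (∑-mono-≤ (f≤g ∘ suc))

∑-mono-< : ∀ {n} {f g : Fin n → ℕ} → (∀ x → f x ≤ g x) → ∀ c → f c < g c → ∑ f < ∑ g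
∑-mono-< {suc n} {f} {g} f≤g zero    fc<gc rewrite ∑-suc f | ∑-suc g =
  +-mono-<-≤ fc<gc (∑-mono-≤ (f≤g ∘ suc))
∑-mono-< {suc n} {f} {g} f≤g (suc c) fc<gc rewrite ∑-suc f | ∑-suc g =
  +-mono-≤-< (f≤g zero) (∑-mono-< (f≤g ∘ suc) c fc<gc)

∑-distrib-+ : ∀ {n} (f g : Fin n → ℕ) → ∑ (λ x → f x + g x) ≡ ∑ f + ∑ g
∑-distrib-+ {zero}  f g = refl
∑-distrib-+ {suc n} f g rewrite ∑-suc (λ x → f x + g x) | ∑-suc f | ∑-suc g
                              | ∑-distrib-+ (f ∘ suc) (g ∘ suc) =
  interchange (f zero) (g zero) (∑ (f ∘ suc)) (∑ (g ∘ suc))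

∑-*ʳ : ∀ {n} (f : Fin n → ℕ) c → ∑ (λ x → f x * c) ≡ ∑ f * c
∑-*ʳ {zero}  f c = refl
∑-*ʳ {suc n} f c rewrite ∑-suc (λ x → f x * c) | ∑-suc f | ∑-*ʳ (f ∘ suc) c =
  sym (*-distribʳ-+ c (f zero) (∑ (f ∘ suc)))

∑-agree-except : ∀ {n} {f g : Fin n → ℕ} c → (∀ x → x ≢ c → f x ≡ g x) →
  f c + ∑ g ≡ g c + ∑ f
∑-agree-except {suc n} {f} {g} zero f≗g rewrite ∑-suc f | ∑-suc g
                                              | ∑-cong {f = g ∘ suc} (λ x → sym (f≗g (suc x) λ ())) =
  x∙yz≈y∙xz (f zero) (g zero) (∑ (f ∘ suc))
∑-agree-except {suc n} {f} {g} (suc c) f≗g rewrite ∑-suc f | ∑-suc g | f≗g zero (λ ()) = begin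
  f (suc c) + (g zero + ∑ (g ∘ suc))
    ≡⟨ x∙yz≈y∙xz (f (suc c)) (g zero) _ ⟩
  g zero + (f (suc c) + ∑ (g ∘ suc))
    ≡⟨ cong (g zero +_) (∑-agree-except c (λ x x≢c → f≗g (suc x) (x≢c ∘ suc-injective))) ⟩
  g zero + (g (suc c) + ∑ (f ∘ suc))
    ≡⟨ x∙yz≈y∙xz (g zero) (g (suc c)) _ ⟩
  g (suc c) + (g zero + ∑ (f ∘ suc))  ∎
  where open ≡-Reasoning

∑-zero : ∀ {n} {f : Fin n → ℕ} → (∀ x → f x ≡ 0) → ∑ f ≡ 0
∑-zero {n} f≗0 = trans (∑-cong f≗0) (trans (∑-const n 0) (*-zeroʳ n))

∑-supported : ∀ {n} {f : Fin n → ℕ} c → (∀ x → x ≢ c → f x ≡ 0) → ∑ f ≡ f c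
∑-supported {n} {f} c vanishes = begin
  ∑ f                   ≡⟨ ∑-agree-except c vanishes ⟨
  f c + ∑ {n} (λ _ → 0) ≡⟨ cong (f c +_) (∑-zero {n} (λ _ → refl)) ⟩
  f c + 0               ≡⟨ +-identityʳ (f c) ⟩
  f c                   ∎
  where open ≡-Reasoning

indicator≤1 : ∀ b → indicator b ≤ 1
indicator≤1 true  = ≤-refl
indicator≤1 false = z≤n

count-empty : ∀ {n} {p : Fin n → Bool} → (∀ j → p j ≡ false) → count p ≡ 0
count-empty p≡false = ∑-zero (cong indicator ∘ p≡false)

count-supported : ∀ {n} {p : Fin n → Bool} c → (∀ j → p j ≡ true → j ≡ c) → count p ≤ 1
count-supported {p = p} c only-c =
  ≤-trans (≤-reflexive (∑-supported c (λ j j≢c → cong indicator (¬-not (j≢c ∘ only-c j)))))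
          (indicator≤1 (p c))

count-mono : ∀ {n} {p q : Fin n → Bool} → (∀ j → p j ≡ true → q j ≡ true) → count p ≤ count q
count-mono {p = p} {q} p⇒q = ∑-mono-≤ pointwise
  where
  pointwise : ∀ j → indicator (p j) ≤ indicator (q j)
  pointwise j with p j in pj
  ... | false = z≤n
  ... | true rewrite p⇒q j pj = ≤-refl

∑≤count* : ∀ {n} {f : Fin n → ℕ} {p : Fin n → Bool} c →
  (∀ x → f x ≤ c) → (∀ x → 0 < f x → T (p x)) → ∑ f ≤ count p * c
∑≤count* {f = f} {p} c f≤c support = ≤-trans (∑-mono-≤ pointwise) (≤-reflexive (∑-*ʳ (indicator ∘ p) c))
  where
  pointwise : ∀ x → f x ≤ indicator (p x) * c
  pointwise x with p x in px
  ... | true  = ≤-trans (f≤c x) (≤-reflexive (sym (*-identityˡ c)))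
  ... | false = ≮⇒≥ (λ positive → subst T px (support x positive))

degree≤maxDegree : ∀ {n} (G : Graph n) v → degree G v ≤ maxDegree G
degree≤maxDegree G v = ≤-foldr-⊔ (∈-map⁺ (degree G) (∈-allFin v))

universal-vertex-degree : ∀ {n} (G : Graph n) v → (∀ x → x ≢ v → adj G v x ≡ true) → suc (degree G v) ≡ n
universal-vertex-degree {n} G v adjacent-to-all = begin
  suc (degree G v)                        ≡⟨ ∑-agree-except v (λ x x≢v → cong indicator (adjacent-to-all x x≢v)) ⟨
  indicator (adj G v v) + ∑ {n} (λ _ → 1) ≡⟨ cong (λ b → indicator b + ∑ {n} (λ _ → 1)) (irrefl G v) ⟩
  ∑ {n} (λ _ → 1)                        ≡⟨ ∑-const n 1 ⟩
  n * 1                                   ≡⟨ *-identityʳ n ⟩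
  n                                       ∎
  where open ≡-Reasoning

non-neighbour : ∀ {n} (G : Graph n) v → suc (degree G v) < n → ∃ λ x → x ≢ v × adj G v x ≡ false
non-neighbour G v room with any? (λ x → ¬? (x ≟ v) ×-dec (adj G v x ≟ᵇ false))
... | yes found = found
... | no none = ⊥-elim (<-irrefl (universal-vertex-degree G v adjacent) room)
  where
  adjacent : ∀ x → x ≢ v → adj G v x ≡ true
  adjacent x x≢v = ¬-not (λ v≁x → none (x , x≢v , v≁x))

neighbour-outside : ∀ {n} (G : Graph n) v x → degree G v < degree G x →
  ∃ λ y → adj G x y ≡ true × adj G v y ≡ false
neighbour-outside G v x v<x with any? (λ y → (adj G x y ≟ᵇ true) ×-dec (adj G v y ≟ᵇ false))
... | yes found = found
... | no none = ⊥-elim (<⇒≱ v<x (count-mono (λ y x∼y → ¬-not (λ v≁y → none (y , x∼y , v≁y)))))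

IsSeparationVertex⇒isSep : ∀ {n} (G : Graph n) v → IsSeparationVertex G v → T (isSep G v)
IsSeparationVertex⇒isSep G v (w , v∼w , v<w) =
  any⁺ _ (lose (∈-allFin w) (Equivalence.from T-∧ (Equivalence.from T-≡ v∼w , fromWitness v<w)))

SamePair : ∀ {n} → Fin n → Fin n → Fin n → Fin n → Set
SamePair i j a b = (i ≡ a × j ≡ b) ⊎ (i ≡ b × j ≡ a)

samePair? : ∀ {n} (i j a b : Fin n) → Dec (SamePair i j a b)
samePair? i j a b = (i ≟ a ×-dec j ≟ b) ⊎-dec (i ≟ b ×-dec j ≟ a)

module _ {n : ℕ} {a b : Fin n} where

  samePair-comm : ∀ {i j} → SamePair i j a b → SamePair j i a b
  samePair-comm = Sum.swap ∘ Sum.map Product.swap Product.swap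

  samePair-diagonal : ∀ {i} → SamePair i i a b → a ≡ b
  samePair-diagonal (inj₁ (refl , refl)) = refl
  samePair-diagonal (inj₂ (refl , refl)) = refl

  partner-unique : a ≢ b → ∀ {c d j} → SamePair c d a b → SamePair c j a b → j ≡ d
  partner-unique _   (inj₁ (refl , refl)) (inj₁ (_ , refl))   = refl
  partner-unique a≢b (inj₁ (refl , _))    (inj₂ (c≡b , _))    = ⊥-elim (a≢b c≡b)
  partner-unique a≢b (inj₂ (refl , _))    (inj₁ (c≡a , _))    = ⊥-elim (a≢b (sym c≡a))
  partner-unique _   (inj₂ (refl , refl)) (inj₂ (_ , refl))   = refl

toggle : ∀ {n} (G : Graph n) (a b : Fin n) → a ≢ b → Graph n
toggle G a b a≢b = record
  { adj    = λ i j → adj G i j xor does (samePair? i j a b)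
  ; sym    = λ i j → cong₂ _xor_ (Graph.sym G i j)
                        (does-⇔ (mk⇔ samePair-comm samePair-comm) (samePair? i j a b) (samePair? j i a b))
  ; irrefl = λ i → cong₂ _xor_ (irrefl G i) (dec-false (samePair? i i a b) (a≢b ∘ samePair-diagonal))
  }

module _ {n : ℕ} (G : Graph n) {a b : Fin n} (a≢b : a ≢ b) where

  private
    G′ : Graph n
    G′ = toggle G a b a≢b

  adj-toggle-outside : ∀ {i j} → ¬ SamePair i j a b → adj G′ i j ≡ adj G i j
  adj-toggle-outside {i} {j} ¬ij =
    trans (cong (adj G i j xor_) (dec-false (samePair? i j a b) ¬ij)) (xor-identityʳ _)

  adj-toggle-other : ∀ {i} → i ≢ a → i ≢ b → ∀ j → adj G′ i j ≡ adj G i j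
  adj-toggle-other i≢a i≢b j = adj-toggle-outside Sum.[ i≢a ∘ proj₁ , i≢b ∘ proj₁ ]

  adj-toggle-endpoint : ∀ {c d} → SamePair c d a b → ∀ j → adj G′ c j ≡ adj G c j xor does (j ≟ d)
  adj-toggle-endpoint cd j =
    cong (adj G _ j xor_) (does-⇔ (mk⇔ (partner-unique a≢b cd) (λ { refl → cd })) (samePair? _ j a b) (j ≟ _))

  adj-toggle-endpoint-other : ∀ {c d} → SamePair c d a b → ∀ {j} → j ≢ d → adj G′ c j ≡ adj G c j
  adj-toggle-endpoint-other {c} cd {j} j≢d =
    trans (adj-toggle-endpoint cd j) (trans (cong (adj G c j xor_) (dec-false (j ≟ _) j≢d)) (xor-identityʳ _))

  degree-toggle-other : ∀ {w} → w ≢ a → w ≢ b → degree G′ w ≡ degree G w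
  degree-toggle-other w≢a w≢b = ∑-cong (cong indicator ∘ adj-toggle-other w≢a w≢b)

  degree-toggle-endpoint : ∀ {c d} → SamePair c d a b →
    indicator (not (adj G c d)) + degree G c ≡ indicator (adj G c d) + degree G′ c
  degree-toggle-endpoint {c} {d} cd =
    trans (cong (λ x → indicator x + degree G c) (sym flipped))
          (∑-agree-except d (λ j j≢d → cong indicator (adj-toggle-endpoint-other cd j≢d)))
    where
    flipped : adj G′ c d ≡ not (adj G c d)
    flipped = trans (adj-toggle-endpoint cd d)
                    (trans (cong (adj G c d xor_) (dec-true (d ≟ d) refl)) (xor-comm (adj G c d) true))

  degree-toggle-add : ∀ {c d} → SamePair c d a b → adj G c d ≡ false → degree G′ c ≡ suc (degree G c)
  degree-toggle-add {c} {d} cd c≁d with adj G c d | degree-toggle-endpoint cd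
  ... | false | counted = sym counted

  degree-toggle-remove : ∀ {c d} → SamePair c d a b → adj G c d ≡ true → degree G c ≡ suc (degree G′ c)
  degree-toggle-remove {c} {d} cd c∼d with adj G c d | degree-toggle-endpoint cd
  ... | true | counted = counted

module _ {n : ℕ} where

  private
    upperDiff : Graph n → Graph n → Fin n → Fin n → Bool
    upperDiff G H i j = ⌊ toℕ i <? toℕ j ⌋ ∧ (adj G i j xor adj H i j)

  editDistance-refl : (G : Graph n) → editDistance G G ≡ 0
  editDistance-refl G = ∑-zero λ i → count-empty λ j →
    trans (cong (⌊ toℕ i <? toℕ j ⌋ ∧_) (xor-same (adj G i j))) (∧-zeroʳ _)

  editDistance-triangle : (G H K : Graph n) → editDistance G K ≤ editDistance G H + editDistance H K
  editDistance-triangle G H K =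
    ≤-trans (∑-mono-≤ λ i →
              ≤-trans (∑-mono-≤ λ j → triangle ⌊ toℕ i <? toℕ j ⌋ (adj G i j) (adj H i j) (adj K i j))
                      (≤-reflexive (∑-distrib-+ (indicator ∘ upperDiff G H i) (indicator ∘ upperDiff H K i))))
            (≤-reflexive (∑-distrib-+ (count ∘ upperDiff G H) (count ∘ upperDiff H K)))
    where
    triangle : ∀ c x y z → indicator (c ∧ (x xor z)) ≤ indicator (c ∧ (x xor y)) + indicator (c ∧ (y xor z))
    triangle false _     _     _     = z≤n
    triangle true  true  true  true  = z≤n
    triangle true  true  true  false = s≤s z≤n
    triangle true  true  false true  = z≤n
    triangle true  true  false false = s≤s z≤n
    triangle true  false true  true  = s≤s z≤n
    triangle true  false true  false = z≤n
    triangle true  false false true  = s≤s z≤n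
    triangle true  false false false = z≤n

  private
    xor≡true⇒≢ : ∀ {x y} → x xor y ≡ true → x ≢ y
    xor≡true⇒≢ {x} x⊕x≡true refl with trans (sym x⊕x≡true) (xor-same x)
    ... | ()

    editDistance-upper-pair : (G H : Graph n) {a b : Fin n} → toℕ a ≤ toℕ b →
      (∀ i j → adj G i j ≢ adj H i j → SamePair i j a b) → editDistance G H ≤ 1
    editDistance-upper-pair G H {a} {b} a≤b differ =
      ≤-trans (≤-reflexive (∑-supported a other-rows-empty))
              (count-supported b (λ j → proj₂ ∘ located {a} {j}))
      where
      located : ∀ {i j} → upperDiff G H i j ≡ true → i ≡ a × j ≡ b
      located {i} {j} entry with toℕ i <? toℕ j
      ... | yes i<j with differ i j (xor≡true⇒≢ entry)
      ...   | inj₁ ab              = ab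
      ...   | inj₂ (refl , refl)   = ⊥-elim (<⇒≱ i<j a≤b)
      other-rows-empty : ∀ i → i ≢ a → count (upperDiff G H i) ≡ 0
      other-rows-empty i i≢a = count-empty (λ j → ¬-not (i≢a ∘ proj₁ ∘ located {i} {j}))

  editDistance-one-pair : (G H : Graph n) (a b : Fin n) →
    (∀ i j → adj G i j ≢ adj H i j → SamePair i j a b) → editDistance G H ≤ 1
  editDistance-one-pair G H a b differ with ≤-total (toℕ a) (toℕ b)
  ... | inj₁ a≤b = editDistance-upper-pair G H a≤b differ
  ... | inj₂ b≤a = editDistance-upper-pair G H b≤a (λ i j → Sum.swap ∘ differ i j)

  editDistance-toggle : (G : Graph n) {a b : Fin n} (a≢b : a ≢ b) → editDistance G (toggle G a b a≢b) ≤ 1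
  editDistance-toggle G {a} {b} a≢b = editDistance-one-pair G (toggle G a b a≢b) a b differ
    where
    differ : ∀ i j → adj G i j ≢ adj (toggle G a b a≢b) i j → SamePair i j a b
    differ i j changed = decidable-stable (samePair? i j a b) (changed ∘ sym ∘ adj-toggle-outside G a≢b)

module Switch {n} (G : Graph n) {v x y : Fin n} (x≢v : x ≢ v)
  (v≁x : adj G v x ≡ false) (x∼y : adj G x y ≡ true) (v≁y : adj G v y ≡ false) where

  private
    x≢y : x ≢ y
    x≢y refl = contradiction (trans (sym (irrefl G x)) x∼y) λ ()

    y≢v : y ≢ v
    y≢v refl = contradiction (trans (sym v≁x) (trans (Graph.sym G v x) x∼y)) λ ()

    v≢x : v ≢ x
    v≢x = x≢v ∘ sym

    v≢y : v ≢ y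
    v≢y = y≢v ∘ sym

    G₁ G₂ : Graph n
    G₁ = toggle G x y x≢y
    G₂ = toggle G₁ v x v≢x

    v≁₁x : adj G₁ v x ≡ false
    v≁₁x = trans (adj-toggle-other G x≢y v≢x v≢y x) v≁x

    v≁₂y : adj G₂ v y ≡ false
    v≁₂y = trans (adj-toggle-endpoint-other G₁ v≢x (inj₁ (refl , refl)) (x≢y ∘ sym))
                 (trans (adj-toggle-other G x≢y v≢x v≢y y) v≁y)

  switched : Graph n
  switched = toggle G₂ v y v≢y

  degree-switched-centre : degree switched v ≡ suc (suc (degree G v))
  degree-switched-centre = begin
    degree switched v     ≡⟨ degree-toggle-add G₂ v≢y (inj₁ (refl , refl)) v≁₂y ⟩
    suc (degree G₂ v)     ≡⟨ cong suc (degree-toggle-add G₁ v≢x (inj₁ (refl , refl)) v≁₁x) ⟩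
    suc (suc (degree G₁ v)) ≡⟨ cong (λ d → suc (suc d)) (degree-toggle-other G x≢y v≢x v≢y) ⟩
    suc (suc (degree G v)) ∎
    where open ≡-Reasoning

  degree-switched-other : ∀ {w} → w ≢ v → degree switched w ≡ degree G w
  degree-switched-other {w} w≢v = by-cases (w ≟ x) (w ≟ y)
    where
    open ≡-Reasoning
    by-cases : Dec (w ≡ x) → Dec (w ≡ y) → degree switched w ≡ degree G w
    by-cases (yes refl) _ = begin
      degree switched x ≡⟨ degree-toggle-other G₂ v≢y x≢v x≢y ⟩
      degree G₂ x       ≡⟨ degree-toggle-add G₁ v≢x (inj₂ (refl , refl)) (trans (Graph.sym G₁ x v) v≁₁x) ⟩
      suc (degree G₁ x) ≡⟨ degree-toggle-remove G x≢y (inj₁ (refl , refl)) x∼y ⟨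
      degree G x        ∎
    by-cases (no w≢x) (yes refl) = begin
      degree switched y ≡⟨ degree-toggle-add G₂ v≢y (inj₂ (refl , refl)) (trans (Graph.sym G₂ y v) v≁₂y) ⟩
      suc (degree G₂ y) ≡⟨ cong suc (degree-toggle-other G₁ v≢x y≢v w≢x) ⟩
      suc (degree G₁ y) ≡⟨ degree-toggle-remove G x≢y (inj₂ (refl , refl)) (trans (Graph.sym G y x) x∼y) ⟨
      degree G y        ∎
    by-cases (no w≢x) (no w≢y) = begin
      degree switched w ≡⟨ degree-toggle-other G₂ v≢y w≢v w≢y ⟩
      degree G₂ w       ≡⟨ degree-toggle-other G₁ v≢x w≢v w≢x ⟩
      degree G₁ w       ≡⟨ degree-toggle-other G x≢y w≢x w≢y ⟩
      degree G w        ∎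

  editDistance-switched : editDistance G switched ≤ 3
  editDistance-switched = begin
    editDistance G switched
      ≤⟨ editDistance-triangle G G₁ switched ⟩
    editDistance G G₁ + editDistance G₁ switched
      ≤⟨ +-monoʳ-≤ _ (editDistance-triangle G₁ G₂ switched) ⟩
    editDistance G G₁ + (editDistance G₁ G₂ + editDistance G₂ switched)
      ≤⟨ +-mono-≤ (editDistance-toggle G x≢y) (+-mono-≤ (editDistance-toggle G₁ v≢x) (editDistance-toggle G₂ v≢y)) ⟩
    3 ∎
    where open ≤-Reasoning

module Repair {n} (Δ : ℕ) (Δ≤n : Δ ≤ n) where

  Bounded : Graph n → Set
  Bounded G = ∀ v → degree G v ≤ Δ

  AlmostRegular : Graph n → Set
  AlmostRegular G = ∀ v → degree G v ≡ Δ ⊎ degree G v ≡ Δ ∸ 1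

  deficiency : Graph n → ℕ
  deficiency G = ∑ λ v → (Δ ∸ 1) ∸ degree G v

  record Augmentation (G : Graph n) (v : Fin n) : Set where
    field
      graph    : Graph n
      bounded  : Bounded graph
      monotone : ∀ w → degree G w ≤ degree graph w
      grows    : degree G v < degree graph v
      cost     : editDistance G graph ≤ 3

  augmentation-reduces-deficiency : ∀ {G v} (A : Augmentation G v) → degree G v < Δ ∸ 1 →
    deficiency (Augmentation.graph A) < deficiency G
  augmentation-reduces-deficiency {v = v} A deficient =
    ∑-mono-< (λ w → ∸-monoʳ-≤ (Δ ∸ 1) (monotone w)) v
             (≤-<-trans (∸-monoʳ-≤ (Δ ∸ 1) grows) (∸-monoʳ-< (n<1+n _) deficient))
    where open Augmentation A

  augment-by-edge : ∀ {G v u} → Bounded G → degree G v < Δ ∸ 1 →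
    u ≢ v → adj G v u ≡ false → degree G u < Δ → Augmentation G v
  augment-by-edge {G} {v} {u} bounded deficient u≢v v≁u u<Δ = record
    { graph    = G′
    ; bounded  = proj₁ ∘ settled
    ; monotone = proj₂ ∘ settled
    ; grows    = ≤-reflexive (sym degree-v)
    ; cost     = ≤-trans (editDistance-toggle G v≢u) (s≤s z≤n)
    }
    where
    v≢u : v ≢ u
    v≢u = u≢v ∘ sym
    G′ : Graph n
    G′ = toggle G v u v≢u
    degree-v : degree G′ v ≡ suc (degree G v)
    degree-v = degree-toggle-add G v≢u (inj₁ (refl , refl)) v≁u
    degree-u : degree G′ u ≡ suc (degree G u)
    degree-u = degree-toggle-add G v≢u (inj₂ (refl , refl)) (trans (Graph.sym G u v) v≁u)
    settled : ∀ w → degree G′ w ≤ Δ × degree G w ≤ degree G′ w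
    settled w = by-cases (w ≟ v) (w ≟ u)
      where
      by-cases : Dec (w ≡ v) → Dec (w ≡ u) → degree G′ w ≤ Δ × degree G w ≤ degree G′ w
      by-cases (yes refl) _        rewrite degree-v = <⇒≤ (<∸1⇒suc< deficient) , n≤1+n _
      by-cases (no _)     (yes refl) rewrite degree-u = u<Δ , n≤1+n _
      by-cases (no w≢v)   (no w≢u)   rewrite degree-toggle-other G v≢u w≢v w≢u = bounded w , ≤-refl

  augment-by-switch : ∀ {G v x y} → Bounded G → degree G v < Δ ∸ 1 →
    x ≢ v → adj G v x ≡ false → adj G x y ≡ true → adj G v y ≡ false → Augmentation G v
  augment-by-switch {G} {v} bounded deficient x≢v v≁x x∼y v≁y = record
    { graph    = switched
    ; bounded  = proj₁ ∘ settled
    ; monotone = proj₂ ∘ settled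
    ; grows    = ≤-trans (n≤1+n _) (≤-reflexive (sym degree-switched-centre))
    ; cost     = editDistance-switched
    }
    where
    open Switch G x≢v v≁x x∼y v≁y
    settled : ∀ w → degree switched w ≤ Δ × degree G w ≤ degree switched w
    settled w = by-cases (w ≟ v)
      where
      by-cases : Dec (w ≡ v) → degree switched w ≤ Δ × degree G w ≤ degree switched w
      by-cases (yes refl) rewrite degree-switched-centre = <∸1⇒suc< deficient , m≤n+m _ 2
      by-cases (no w≢v)   rewrite degree-switched-other w≢v = bounded w , ≤-refl

  augment : ∀ {G v} → Bounded G → degree G v < Δ ∸ 1 → Augmentation G v
  augment {G} {v} bounded deficient
    with any? (λ u → ¬? (u ≟ v) ×-dec (adj G v u ≟ᵇ false) ×-dec (degree G u <? Δ))
  ... | yes (u , u≢v , v≁u , u<Δ) = augment-by-edge bounded deficient u≢v v≁u u<Δ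
  ... | no no-partner with non-neighbour G v (<-≤-trans (<∸1⇒suc< deficient) Δ≤n)
  ...   | x , x≢v , v≁x with neighbour-outside G v x (<-≤-trans v<Δ Δ≤x)
    where
    v<Δ : degree G v < Δ
    v<Δ = <-trans (n<1+n _) (<∸1⇒suc< deficient)
    Δ≤x : Δ ≤ degree G x
    Δ≤x = ≮⇒≥ (λ x<Δ → no-partner (x , x≢v , v≁x , x<Δ))
  ...     | y , x∼y , v≁y = augment-by-switch bounded deficient x≢v v≁x x∼y v≁y

  Repaired : Graph n → Set
  Repaired G = Σ (Graph n) λ H → editDistance G H ≤ 3 * deficiency G × AlmostRegular H

  repair : ∀ fuel G → Bounded G → deficiency G ≤ fuel → Repaired G
  repair fuel G bounded fuelled with any? (λ v → degree G v <? Δ ∸ 1)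
  ... | no none-deficient =
    G , ≤-trans (≤-reflexive (editDistance-refl G)) z≤n , λ v →
      m≤n∧n∸1≤m⇒m≡n⊎m≡n∸1 (bounded v) (≮⇒≥ (none-deficient ∘ (v ,_)))
  ... | yes (v , deficient) = continue fuel fuelled
    where
    A : Augmentation G v
    A = augment bounded deficient
    open Augmentation A renaming (bounded to bounded′)
    reduced : deficiency graph < deficiency G
    reduced = augmentation-reduces-deficiency A deficient
    extend : Repaired graph → Repaired G
    extend (H , cost′ , regular) = H , total , regular
      where
      total : editDistance G H ≤ 3 * deficiency G
      total = begin
        editDistance G H                        ≤⟨ editDistance-triangle G graph H ⟩
        editDistance G graph + editDistance graph H ≤⟨ +-mono-≤ cost cost′ ⟩
        3 + 3 * deficiency graph                ≡⟨ *-suc 3 (deficiency graph) ⟨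
        3 * suc (deficiency graph)              ≤⟨ *-monoʳ-≤ 3 reduced ⟩
        3 * deficiency G                        ∎
        where open ≤-Reasoning
    continue : ∀ fuel → deficiency G ≤ fuel → Repaired G
    continue zero       fuelled = contradiction (<-≤-trans reduced fuelled) n≮0
    continue (suc fuel) fuelled = extend (repair fuel graph bounded′ (s≤s⁻¹ (<-≤-trans reduced fuelled)))

  deficiency≤numSeparationVertices*Δ : ∀ G → (∀ v → degree G v < Δ → IsSeparationVertex G v) →
    deficiency G ≤ numSeparationVertices G * Δ
  deficiency≤numSeparationVertices*Δ G separated =
    ∑≤count* Δ (λ v → ≤-trans (m∸n≤m _ (degree G v)) (m∸n≤m Δ 1))
      (λ v positive → IsSeparationVertex⇒isSep G v (separated v
        (<-≤-trans (m∸n≢0⇒n<m (n>0⇒n≢0 positive)) (m∸n≤m Δ 1))))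

proposition3 : ∀ {n} (G : Graph n) →
    (∀ v → degree G v < maxDegree G → IsSeparationVertex G v) →
    2 * maxDegree G + maxDegree G * maxDegree G
      + maxDegree G * maxDegree G * maxDegree G ≤ n →
    Σ (Graph n) λ H →
      editDistance G H ≤ 3 * numSeparationVertices G * maxDegree G
      × (∀ v → degree H v ≡ maxDegree G ⊎ degree H v ≡ maxDegree G ∸ 1)
proposition3 {n} G separated size =
  let H , cost , regular = repair (deficiency G) G (degree≤maxDegree G) ≤-refl
  in H , ≤-trans cost (≤-trans (*-monoʳ-≤ 3 (deficiency≤numSeparationVertices*Δ G separated))
                                (≤-reflexive (sym (*-assoc 3 (numSeparationVertices G) Δ)))) , regular
  where
  Δ : ℕ
  Δ = maxDegree G
  -- The size hypothesis is only used through its consequence Δ ≤ n.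
  Δ≤n : Δ ≤ n
  Δ≤n = ≤-trans (m≤m+n Δ (Δ + 0)) (≤-trans (m≤m+n _ _) (≤-trans (m≤m+n _ _) size))
  open Repair Δ Δ≤n
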